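{- Let $k\ge 3$ and consider the network $M_k$. If the initial content of the registers is a 2-sorted 0-1 sequence $x\in\{0,1\}^{N_k}$, then after each stage of the multi-pass computation of $M_k$ (i.e. after applying any finite prefix of the stage sequence $T^k_1,T^k_2,T^k_3,T^k_1,T^k_2,T^k_3,\dots$), the content of each column $C_j$, $j=1,\dots,b_k$, read in increasing register order, is sorted, i.e. of the form $0^*1^*$.
   Context: Let $n_k=2^{k-1}-1$, $b_k=2(k-2)$, $N_k=n_kb_k$; registers are $1,\dots,N_k$ with content $x=(x_1,\dots,x_{N_k})$. A comparator $[a:b]$ ($a<b$) replaces $(x_a,x_b)$ by $(\min(x_a,x_b),\max(x_a,x_b))$. Define comparator sets $S_{k,1}=\{[b_ki:b_ki+1]: i=1,\dots,n_k-1\}$ and, for $j=1,\dots,k-2$, $S_{k,2j}=\{[b_ki+j:\ b_k(i+2^{k-j-1}-1)+b_k-j+1]: i=0,\dots,n_k-2^{k-j-1}\}$ and $S_{k,2j+1}=\{[b_ki+j:b_ki+j+1],\ [b_ki+b_k-j:b_ki+b_k-j+1]: i=0,\dots,n_k-1\}$. For $r=1,2,3$ let $T^k_r=\bigcup\{S_{k,m}: 1\le m\le 2k-3,\ m\equiv r\pmod 3\}$; the comparators of each $T^k_r$ act on pairwise disjoint pairs of registers and are applied simultaneously. $M_k$ is the 3-periodic network whose pass applies $T^k_1$, then $T^k_2$, then $T^k_3$; a multi-pass computation repeats passes. Columns: $C_j=\{j+ib_k: 0\le i\le n_k-1\}$ for $j=1,\dots,b_k$. A sequence $x$ is 2-sorted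 if $(x_1,x_3,\dots,x_{N_k-1})$ and $(x_2,x_4,\dots,x_{N_k})$ are both nondecreasing. -}

module Defs where

open import Data.Nat using (ℕ; zero; suc; _+_; _*_; _∸_; _^_; _≤_; _<_; _≡ᵇ_)
open import Data.Nat.DivMod using (_%_; _/_)
open import Data.Nat.Properties using (_≟_)
open import Data.Bool using (Bool; true; false; if_then_else_; _∧_; _∨_)
import Data.Bool as B
open import Data.List using (List; []; _∷_; map; upTo; concatMap; filter)
open import Data.Product using (_×_; _,_)
open import Relation.Binary.PropositionalEquality using (_≡_)

-- Register contents: register r (1 ≤ r ≤ N k) holds the bit x r (false = 0, true = 1).
Content : Set
Content = ℕ → Bool

-- A comparator [a:b] is the pair (a , b) with a < b.
Comparator : Set
Comparator = ℕ × ℕ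

n : ℕ → ℕ
n k = 2 ^ (k ∸ 1) ∸ 1

b : ℕ → ℕ
b k = 2 * (k ∸ 2)

N : ℕ → ℕ
N k = n k * b k

S₁ : ℕ → List Comparator
S₁ k = map (λ i → (b k * suc i , b k * suc i + 1)) (upTo (n k ∸ 1))

S-even : ℕ → ℕ → List Comparator
S-even k j =
  map (λ i → (b k * i + j , b k * (i + 2 ^ (k ∸ j ∸ 1) ∸ 1) + b k ∸ j + 1))
      (upTo (n k ∸ 2 ^ (k ∸ j ∸ 1) + 1))

S-odd : ℕ → ℕ → List Comparator
S-odd k j =
  concatMap (λ i → (b k * i + j , b k * i + j + 1)
                 ∷ (b k * i + b k ∸ j , b k * i + b k ∸ j + 1) ∷ [])
            (upTo (n k))

S : ℕ → ℕ → List Comparator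
S k m = if m ≡ᵇ 1 then S₁ k
        else if (m % 2) ≡ᵇ 0 then S-even k (m / 2)
        else S-odd k (m / 2)

T : ℕ → ℕ → List Comparator
T k r = concatMap (S k) (filter (λ m → m % 3 ≟ r % 3) (map suc (upTo (2 * k ∸ 3))))

-- Simultaneous application of a layer of comparators (on pairwise disjoint
-- register pairs): every register reads the OLD content x.
applyLayer : List Comparator → Content → Content
applyLayer [] x r = x r
applyLayer ((a , c) ∷ cs) x r =
  if r ≡ᵇ a then x a ∧ x c
  else if r ≡ᵇ c then x a ∨ x c
  else applyLayer cs x r

run : ℕ → Content → ℕ → Content
run k x zero = x
run k x (suc s) = applyLayer (T k (s % 3 + 1)) (run k x s)

-- 2-sorted: the odd-indexed and the even-indexed subsequences of x_1 … x_N are nondecreasing.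
TwoSorted : ℕ → Content → Set
TwoSorted k x = ∀ p q → 1 ≤ p → p ≤ q → q ≤ N k → p % 2 ≡ q % 2 → x p B.≤ x q

ColumnSorted : ℕ → Content → ℕ → Set
ColumnSorted k x j = ∀ i i′ → i ≤ i′ → i′ < n k → x (j + i * b k) B.≤ x (j + i′ * b k)

-- Number register j + i b of M_k as row i of column j.  Every comparator of
-- every S_{k,m} joins a register in a fixed column j₁ and row i to one in a
-- fixed column j₂ and row i + d, so it compares column j₁ pointwise with
-- column j₂ shifted by d; applied to two sorted columns this keeps j₁ sorted
-- (pointwise min) and j₂ sorted (pointwise max).  A column at distance g from
-- the nearer edge is only touched by S_{k,2g+1}, S_{k,2g+2} and S_{k,2g+3},
-- which lie in three different layers T^k_r; so inside one layer every column
-- plays a single role, and each layer preserves sortedness of all columns.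
-- Initially the columns are sorted because b_k is even and x is 2-sorted.

module Submission where

open import Defs
open import Data.Bool using (Bool; true; false; _∧_; _∨_)
import Data.Bool as B
import Data.Bool.Properties as BP
open import Data.Empty using (⊥-elim)
open import Data.List using (List; _∷_; []; map; upTo; concatMap; filter)
open import Data.List.Membership.Propositional using (_∈_; find; lose)
open import Data.List.Membership.Propositional.Properties
  using (∈-map⁺; ∈-map⁻; ∈-upTo⁺; ∈-upTo⁻; ∈-concatMap⁺; ∈-concatMap⁻; ∈-filter⁺; ∈-filter⁻)
open import Data.List.Relation.Unary.Any using (here; there)
open import Data.Nat
open import Data.Nat.DivMod
  using (%-distribˡ-+; m%n<n; m%n%n≡m%n; [m+kn]%n≡m%n; m*n%n≡0; m*n/n≡m; +-distrib-/)
open import Data.Nat.Properties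
open import Data.Nat.Tactic.RingSolver using (solve-∀)
open import Data.Product using (Σ; _×_; _,_; proj₁; proj₂; map₂)
open import Data.Sum using (_⊎_; inj₁; inj₂; [_,_])
open import Function using (_∘_)
open import Relation.Nullary using (¬_; yes; no)
open import Relation.Nullary.Decidable using (dec-true; dec-false)
open import Relation.Binary.PropositionalEquality hiding ([_])

∧-≤ˡ : ∀ a c → a ∧ c B.≤ a
∧-≤ˡ false _ = B.b≤b
∧-≤ˡ true  c = BP.≤-maximum c

∨-≥ʳ : ∀ a c → c B.≤ a ∨ c
∨-≥ʳ false _ = BP.≤-refl
∨-≥ʳ true  c = BP.≤-maximum c

∧-mono-≤ : ∀ {a a′ c c′} → a B.≤ a′ → c B.≤ c′ → a ∧ c B.≤ a′ ∧ c′
∧-mono-≤ B.f≤t _ = BP.≤-minimum _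
∧-mono-≤ {false} B.b≤b _ = B.b≤b
∧-mono-≤ {true}  B.b≤b c≤c′ = c≤c′

∨-mono-≤ : ∀ {a a′ c c′} → a B.≤ a′ → c B.≤ c′ → a ∨ c B.≤ a′ ∨ c′
∨-mono-≤ B.f≤t _ = BP.≤-maximum _
∨-mono-≤ {false} B.b≤b c≤c′ = c≤c′
∨-mono-≤ {true}  B.b≤b _ = B.b≤b

Sorted : ℕ → (ℕ → Bool) → Set
Sorted n f = ∀ i → suc i < n → f i B.≤ f (suc i)

Sorted⇒monotone : ∀ {n f} → Sorted n f → ∀ {i i′} → i ≤ i′ → i′ < n → f i B.≤ f i′
Sorted⇒monotone {n} {f} sorted {i} i≤i′ = go (≤⇒≤′ i≤i′)
  where
  go : ∀ {m} → i ≤′ m → m < n → f i B.≤ f m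
  go ≤′-refl _ = BP.≤-refl
  go (≤′-step i≤′m) m+1<n = BP.≤-trans (go i≤′m (<-trans (n<1+n _) m+1<n)) (sorted _ m+1<n)

min-shift-sorted : ∀ {n d f g y} → Sorted n f → Sorted n g →
                   (∀ i → i + d < n → y i ≡ f i ∧ g (i + d)) →
                   (∀ i → ¬ i + d < n → y i ≡ f i) →
                   Sorted n y
min-shift-sorted {n} {d} {f} {g} {y} f↑ g↑ inside outside i i+1<n with suc i + d <? n
... | yes i+1+d<n =
  subst₂ B._≤_ (sym (inside i (<-trans (n<1+n _) i+1+d<n))) (sym (inside (suc i) i+1+d<n))
         (∧-mono-≤ (f↑ i i+1<n) (g↑ (i + d) i+1+d<n))
... | no i+1+d≮n = subst (y i B.≤_) (sym (outside (suc i) i+1+d≮n)) (BP.≤-trans y≤f (f↑ i i+1<n))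
  where
  y≤f : y i B.≤ f i
  y≤f with i + d <? n
  ... | yes i+d<n = subst (B._≤ f i) (sym (inside i i+d<n)) (∧-≤ˡ _ _)
  ... | no i+d≮n  = BP.≤-reflexive (outside i i+d≮n)

max-shift-sorted : ∀ {n d f g y} → Sorted n f → Sorted n g →
                   (∀ i → d ≤ i → i < n → y i ≡ g (i ∸ d) ∨ f i) →
                   (∀ i → i < d → y i ≡ f i) →
                   Sorted n y
max-shift-sorted {n} {d} {f} {g} {y} f↑ g↑ inside outside i i+1<n with d ≤? i
... | yes d≤i =
  subst₂ B._≤_ (sym (inside i d≤i (<-trans (n<1+n i) i+1<n)))
         (sym (trans (inside (suc i) (m≤n⇒m≤1+n d≤i) i+1<n)
                     (cong (λ m → g m ∨ f (suc i)) (+-∸-assoc 1 d≤i))))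
         (∨-mono-≤ (g↑ (i ∸ d) (≤-<-trans (s≤s (m∸n≤m i d)) i+1<n)) (f↑ i i+1<n))
... | no d≰i = subst (B._≤ y (suc i)) (sym (outside i (≰⇒> d≰i))) (BP.≤-trans (f↑ i i+1<n) f≤y)
  where
  f≤y : f (suc i) B.≤ y (suc i)
  f≤y with d ≤? suc i
  ... | yes d≤i+1 = subst (f (suc i) B.≤_) (sym (inside (suc i) d≤i+1 i+1<n)) (∨-≥ʳ _ _)
  ... | no d≰i+1  = BP.≤-reflexive (sym (outside (suc i) (≰⇒> d≰i+1)))

Touches : ℕ → Comparator → Set
Touches p (a , c) = p ≡ a ⊎ p ≡ c

≡⇒≡ᵇ-true : ∀ {m n} → m ≡ n → (m ≡ᵇ n) ≡ true
≡⇒≡ᵇ-true {m} {n} = dec-true (m ≟ n)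

≢⇒≡ᵇ-false : ∀ {m n} → m ≢ n → (m ≡ᵇ n) ≡ false
≢⇒≡ᵇ-false {m} {n} = dec-false (m ≟ n)

applyLayer-untouched : ∀ L x p → (∀ {c} → c ∈ L → ¬ Touches p c) → applyLayer L x p ≡ x p
applyLayer-untouched [] x p _ = refl
applyLayer-untouched ((a , c) ∷ L) x p untouched
  rewrite ≢⇒≡ᵇ-false (untouched (here refl) ∘ inj₁) | ≢⇒≡ᵇ-false (untouched (here refl) ∘ inj₂)
  = applyLayer-untouched L x p (untouched ∘ there)

applyLayer-only : ∀ L x p {a c} → (a , c) ∈ L → Touches p (a , c) →
                  (∀ {c′} → c′ ∈ L → Touches p c′ → c′ ≡ (a , c)) →
                  applyLayer L x p ≡ applyLayer ((a , c) ∷ []) x p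
applyLayer-only ((a′ , c′) ∷ L) x p mem touch only with p ≟ a′ | p ≟ c′
... | yes p≡a′ | _ with refl ← only (here refl) (inj₁ p≡a′)
  rewrite ≡⇒≡ᵇ-true p≡a′ = refl
... | no p≢a′ | yes p≡c′ with refl ← only (here refl) (inj₂ p≡c′)
  rewrite ≢⇒≡ᵇ-false p≢a′ | ≡⇒≡ᵇ-true p≡c′ = refl
... | no p≢a′ | no p≢c′ rewrite ≢⇒≡ᵇ-false p≢a′ | ≢⇒≡ᵇ-false p≢c′ with mem
...   | here refl  = ⊥-elim ([ p≢a′ , p≢c′ ] touch)
...   | there mem′ = applyLayer-only L x p mem′ touch (only ∘ there)

applyLayer-min : ∀ L x {a c} → (a , c) ∈ L →
                 (∀ {c′} → c′ ∈ L → Touches a c′ → c′ ≡ (a , c)) →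
                 applyLayer L x a ≡ x a ∧ x c
applyLayer-min L x {a} mem only
  rewrite applyLayer-only L x a mem (inj₁ refl) only | ≡⇒≡ᵇ-true {a} refl = refl

applyLayer-max : ∀ L x {a c} → c ≢ a → (a , c) ∈ L →
                 (∀ {c′} → c′ ∈ L → Touches c c′ → c′ ≡ (a , c)) →
                 applyLayer L x c ≡ x a ∨ x c
applyLayer-max L x {c = c} c≢a mem only
  rewrite applyLayer-only L x c mem (inj₂ refl) only | ≢⇒≡ᵇ-false c≢a | ≡⇒≡ᵇ-true {c} refl = refl

%3-separates : ∀ m d → 0 < d → d ≤ 2 → (m + d) % 3 ≢ m % 3
%3-separates m d 0<d d≤2 eq =
  separated (m % 3) d (m%n<n m 3) 0<d d≤2 (trans (sym (%-distribˡ-+ m d 3)) eq)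
  where
  separated : ∀ t d → t < 3 → 0 < d → d ≤ 2 → (t + d % 3) % 3 ≢ t
  separated (suc (suc (suc _))) _ (s≤s (s≤s (s≤s ()))) _ _
  separated _ (suc (suc (suc _))) _ _ (s≤s (s≤s ()))
  separated 0 1 _ _ _ ()
  separated 0 2 _ _ _ ()
  separated 1 1 _ _ _ ()
  separated 1 2 _ _ _ ()
  separated 2 1 _ _ _ ()
  separated 2 2 _ _ _ ()

%3-cancelʳ-≤ : ∀ a {e e′} → e ≤ e′ → e′ ≤ 2 → (e + a) % 3 ≡ (e′ + a) % 3 → e ≡ e′
%3-cancelʳ-≤ a {e} e≤e′ e′≤2 eq with m≤n⇒∃[o]m+o≡n e≤e′
... | zero  , refl = sym (+-identityʳ e)
... | suc o , refl = ⊥-elim (%3-separates (a + e) (suc o) z<s (m+n≤o⇒n≤o e e′≤2) (begin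
  (a + e + suc o) % 3   ≡⟨ cong (_% 3) (reorder a e (suc o)) ⟩
  (e + suc o + a) % 3   ≡⟨ sym eq ⟩
  (e + a) % 3           ≡⟨ cong (_% 3) (+-comm e a) ⟩
  (a + e) % 3           ∎))
  where
  open ≡-Reasoning
  reorder : ∀ a e o → a + e + o ≡ e + o + a
  reorder = solve-∀

%3-cancelʳ-window : ∀ a {e e′} → e ≤ 2 → e′ ≤ 2 → (e + a) % 3 ≡ (e′ + a) % 3 → e ≡ e′
%3-cancelʳ-window a {e} {e′} e≤2 e′≤2 eq with ≤-total e e′
... | inj₁ e≤e′ = %3-cancelʳ-≤ a e≤e′ e′≤2 eq
... | inj₂ e′≤e = sym (%3-cancelʳ-≤ a e′≤e e≤2 (sym eq))

-- The witness is e = (r + d a) mod (d + 1), since a + r + d a = r + a (d + 1).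
residue-in-window : ∀ d a r → Σ ℕ λ e → e ≤ d × (e + a) % suc d ≡ r % suc d
residue-in-window d a r = e , ≤-pred (m%n<n (r + d * a) (suc d)) , (begin
  (e + a) % D                 ≡⟨ cong (_% D) (+-comm e a) ⟩
  (a + e) % D                 ≡⟨ %-distribˡ-+ a e D ⟩
  (a % D + e % D) % D         ≡⟨ cong (λ t → (a % D + t) % D) (m%n%n≡m%n (r + d * a) D) ⟩
  (a % D + (r + d * a) % D) % D ≡⟨ sym (%-distribˡ-+ a (r + d * a) D) ⟩
  (a + (r + d * a)) % D       ≡⟨ cong (_% D) (regroup a r d) ⟩
  (r + a * D) % D             ≡⟨ [m+kn]%n≡m%n r a D ⟩
  r % D                       ∎)
  where
  open ≡-Reasoning
  D = suc d
  e = (r + d * a) % D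
  regroup : ∀ a r d → a + (r + d * a) ≡ r + a * suc d
  regroup = solve-∀

+-left-comm : ∀ m n o → m + (n + o) ≡ n + (m + o)
+-left-comm = solve-∀

column-row-injective : ∀ B {j j′} i i′ → 1 ≤ j → j ≤ B → 1 ≤ j′ → j′ ≤ B →
                       j + i * B ≡ j′ + i′ * B → j ≡ j′ × i ≡ i′
column-row-injective B {j} {j′} zero zero _ _ _ _ eq =
  trans (sym (+-identityʳ j)) (trans eq (+-identityʳ j′)) , refl
column-row-injective B (suc i) (suc i′) 1≤j j≤B 1≤j′ j′≤B eq =
  map₂ (cong suc) (column-row-injective B i i′ 1≤j j≤B 1≤j′ j′≤B
    (+-cancelˡ-≡ B _ _ (trans (+-left-comm B _ (i * B)) (trans eq (+-left-comm _ B (i′ * B))))))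
column-row-injective B {j} {j′} zero (suc i′) _ j≤B 1≤j′ _ eq = ⊥-elim (<⇒≢ (begin-strict
  j + 0              ≡⟨ +-identityʳ j ⟩
  j                  ≤⟨ j≤B ⟩
  B                  <⟨ +-monoˡ-≤ B 1≤j′ ⟩
  j′ + B             ≤⟨ +-monoʳ-≤ j′ (m≤m+n B (i′ * B)) ⟩
  j′ + (B + i′ * B)  ∎) eq)
  where open ≤-Reasoning
column-row-injective B (suc i) zero 1≤j j≤B 1≤j′ j′≤B eq =
  ⊥-elim (0≢1+n (proj₂ (column-row-injective B zero (suc i) 1≤j′ j′≤B 1≤j j≤B (sym eq))))

*-suc-comm : ∀ B i → B * suc i ≡ B + i * B
*-suc-comm = solve-∀

wrap-upper-coord : ∀ B i → B * suc i + 1 ≡ 1 + (i + 1) * B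
wrap-upper-coord = solve-∀

row-coord : ∀ B i j → B * i + j ≡ j + i * B
row-coord = solve-∀

next-row-coord : ∀ B i j → B * i + j + 1 ≡ suc j + (i + 0) * B
next-row-coord = solve-∀

row-end-coord : ∀ B i {g} → g < B → B * i + B ∸ suc g ≡ (B ∸ suc g) + i * B
row-end-coord B i {g} g<B = trans (+-∸-assoc (B * i) g<B) (row-coord B i (B ∸ suc g))

-- Truncated subtraction: B ∸ suc g + 1 is B ∸ g only because g < B.
row-end-next-coord : ∀ B i {g} → g < B → B * i + B ∸ suc g + 1 ≡ (B ∸ g) + i * B
row-end-next-coord B i {g} g<B = begin
  B * i + B ∸ suc g + 1           ≡⟨ cong (_+ 1) (row-end-coord B i g<B) ⟩
  (B ∸ suc g) + i * B + 1         ≡⟨ +-comm ((B ∸ suc g) + i * B) 1 ⟩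
  suc (B ∸ suc g + i * B)         ≡⟨ cong (_+ i * B) (sym (+-∸-assoc 1 g<B)) ⟩
  (B ∸ g) + i * B                 ∎
  where open ≡-Reasoning

2*m≤1+2*n⇒m≤n : ∀ {m n} → 2 * m ≤ suc (2 * n) → m ≤ n
2*m≤1+2*n⇒m≤n {m} {n} 2m≤1+2n = ≮⇒≥ λ n<m →
  1+n≰n (≤-trans (≤-reflexive (sym (*-suc 2 n))) (≤-trans (*-monoʳ-≤ 2 n<m) 2m≤1+2n))

m+n≡1+m+[n∸1] : ∀ m n → 1 ≤ n → m + n ≡ suc (m + (n ∸ 1))
m+n≡1+m+[n∸1] m n 1≤n = trans (cong (m +_) (trans (sym (m∸n+n≡m 1≤n)) (+-comm (n ∸ 1) 1))) (+-suc m (n ∸ 1))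

<∸+1⇒+∸1< : ∀ {i D m} → 1 ≤ D → D ≤ m → i < m ∸ D + 1 → i + (D ∸ 1) < m
<∸+1⇒+∸1< {i} {D} {m} 1≤D D≤m lt = subst (_≤ m) (m+n≡1+m+[n∸1] i D 1≤D)
  (m≤o∸n⇒m+n≤o i D≤m (≤-pred (subst (i <_) (+-comm (m ∸ D) 1) lt)))

+∸1<⇒<∸+1 : ∀ {i D m} → 1 ≤ D → i + (D ∸ 1) < m → i < m ∸ D + 1
+∸1<⇒<∸+1 {i} {D} {m} 1≤D lt = subst (i <_) (+-comm 1 (m ∸ D))
  (s≤s (m+n≤o⇒m≤o∸n i (subst (_≤ m) (sym (m+n≡1+m+[n∸1] i D 1≤D)) lt)))

-- Stage even g is S_{k,2(g+1)} and stage odd g is S_{k,2(g+1)+1}; so g + 1 is the paper's j.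
data Stage : Set where
  first : Stage
  even odd : ℕ → Stage

stage-index : Stage → ℕ
stage-index first    = 1
stage-index (even g) = 2 * suc g
stage-index (odd g)  = suc (2 * suc g)

stage-index-positive : ∀ s → 1 ≤ stage-index s
stage-index-positive first    = s≤s z≤n
stage-index-positive (even _) = s≤s z≤n
stage-index-positive (odd _)  = s≤s z≤n

stage-of : ∀ m → Σ Stage λ s → stage-index s ≡ suc m
stage-of zero       = first , refl
stage-of (suc zero) = even 0 , refl
stage-of (suc (suc m)) with stage-of m
... | first  , refl = odd 0 , refl
... | even g , eq   = even (suc g) , trans (*-suc 2 (suc g)) (cong (2 +_) eq)
... | odd g  , eq   = odd (suc g) , trans (cong suc (*-suc 2 (suc g))) (cong (2 +_) eq)

[1+2m]/2≡m : ∀ m → suc (2 * m) / 2 ≡ m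
[1+2m]/2≡m m = trans (cong (λ t → suc t / 2) (*-comm 2 m))
                     (trans (+-distrib-/ 1 (m * 2) (subst (λ t → 1 + t < 2) (sym (m*n%n≡0 m 2)) ≤-refl))
                            (m*n/n≡m m 2))

stage-comparators : ℕ → Stage → List Comparator
stage-comparators k first    = S₁ k
stage-comparators k (even g) = S-even k (suc g)
stage-comparators k (odd g)  = S-odd k (suc g)

S-stage : ∀ k s → S k (stage-index s) ≡ stage-comparators k s
S-stage k first = refl
S-stage k (even g)
  rewrite ≢⇒≡ᵇ-false (even≢odd (suc g) 0)
        | trans (cong (_% 2) (*-comm 2 (suc g))) (m*n%n≡0 (suc g) 2)
        | trans (cong (_/ 2) (*-comm 2 (suc g))) (m*n/n≡m (suc g) 2) = refl
S-stage k (odd g)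
  rewrite ≢⇒≡ᵇ-false {suc (2 * suc g)} {1} (λ ())
        | trans (cong (λ m → suc m % 2) (*-comm 2 (suc g))) ([m+kn]%n≡m%n 1 (suc g) 2)
        | [1+2m]/2≡m (suc g) = refl

odd-stage : ℕ → Stage
odd-stage zero    = first
odd-stage (suc g) = odd g

-- The stages acting on the columns at distance g from an edge are S_{k,2g+1+e}
-- for e = 0, 1, 2.
data Active (g : ℕ) : ℕ → Stage → Set where
  before : Active g 0 (odd-stage g)
  at     : Active g 1 (even g)
  after  : Active g 2 (odd g)

active-index : ∀ {g e s} → Active g e s → stage-index s ≡ e + suc (2 * g)
active-index {zero}  before = refl
active-index {suc g} before = refl
active-index {g}     at     = *-suc 2 g
active-index {g}     after  = cong suc (*-suc 2 g)

active-≤2 : ∀ {g e s} → Active g e s → e ≤ 2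
active-≤2 before = z≤n
active-≤2 at     = s≤s z≤n
active-≤2 after  = ≤-refl

active-injective : ∀ {g e s s′} → Active g e s → Active g e s′ → s ≡ s′
active-injective before before = refl
active-injective at     at     = refl
active-injective after  after  = refl

active-of : ∀ g {e} → e ≤ 2 → Σ Stage (Active g e)
active-of g z≤n                 = odd-stage g , before
active-of g (s≤s z≤n)           = even g , at
active-of g (s≤s (s≤s z≤n))     = odd g , after

span≤n : ∀ k g → 3 ≤ k → 2 ^ (k ∸ suc g ∸ 1) ≤ n k
span≤n (suc (suc k)) g _ = ≤-trans (^-monoʳ-≤ 2 exponent≤) (m+n≤o⇒m≤o∸n P P+1≤2P)
  where
  P = 2 ^ k
  exponent≤ : suc (suc k) ∸ suc g ∸ 1 ≤ k
  exponent≤ = subst (_≤ k) (sym (∸-+-assoc (suc (suc k)) (suc g) 1)) (∸-monoʳ-≤ (suc k) (m≤n+m 1 g))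
  P+1≤2P : P + 1 ≤ 2 * P
  P+1≤2P = +-monoʳ-≤ P (≤-trans (m^n>0 2 k) (≤-reflexive (sym (+-identityʳ P))))
span≤n (suc zero) _ (s≤s ())

2k∸3≡1+2[k∸2] : ∀ k → 3 ≤ k → 2 * k ∸ 3 ≡ suc (2 * (k ∸ 2))
2k∸3≡1+2[k∸2] (suc (suc (suc k))) _ = normalise k
  where
  normalise : ∀ k → k + suc (suc (suc (k + 0))) ≡ suc (suc (k + suc (k + 0)))
  normalise = solve-∀
2k∸3≡1+2[k∸2] (suc zero) (s≤s ())
2k∸3≡1+2[k∸2] (suc (suc zero)) (s≤s (s≤s ()))

module Network (k : ℕ) (3≤k : 3 ≤ k) where

  H : ℕ
  H = k ∸ 2

  0<H : 0 < H
  0<H = ∸-monoˡ-≤ 2 3≤k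

  b≡H+H : b k ≡ H + H
  b≡H+H = cong (H +_) (+-identityʳ H)

  H≤b : H ≤ b k
  H≤b = m≤m+n H (H + 0)

  b∸H≡H : b k ∸ H ≡ H
  b∸H≡H = trans (cong (_∸ H) b≡H+H) (m+n∸m≡n H H)

  H<b∸g : ∀ {g} → g < H → H < b k ∸ g
  H<b∸g {g} g<H = subst (H <_) (sym b∸g≡) (m<m+n H (m<n⇒0<n∸m g<H))
    where
    b∸g≡ : b k ∸ g ≡ H + (H ∸ g)
    b∸g≡ = trans (cong (_∸ g) b≡H+H) (+-∸-assoc H (<⇒≤ g<H))

  b∸g≡1+b∸1+g : ∀ {g} → g < b k → b k ∸ g ≡ suc (b k ∸ suc g)
  b∸g≡1+b∸1+g g<b = +-∸-assoc 1 g<b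

  b∸p≢1+p : ∀ {p} → p ≤ b k → b k ∸ p ≢ suc p
  b∸p≢1+p {p} p≤b b∸p≡1+p = even≢odd H p (begin
    2 * H          ≡⟨ sym (m∸n+n≡m p≤b) ⟩
    b k ∸ p + p    ≡⟨ cong (_+ p) b∸p≡1+p ⟩
    suc (p + p)    ≡⟨ cong (λ q → suc (p + q)) (sym (+-identityʳ p)) ⟩
    suc (2 * p)    ∎)
    where open ≡-Reasoning

  <H⇒<b : ∀ {g} → g < H → g < b k
  <H⇒<b g<H = <-≤-trans g<H H≤b

  register : ℕ → ℕ → ℕ
  register j i = j + i * b k

  column : Content → ℕ → ℕ → Bool
  column x j i = x (register j i)

  Depth : ℕ → ℕ → Set
  Depth j g = g < H × (j ≡ suc g ⊎ j ≡ b k ∸ g)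

  depth-bounds : ∀ {j g} → Depth j g → 1 ≤ j × j ≤ b k
  depth-bounds (g<H , inj₁ refl) = s≤s z≤n , ≤-trans g<H H≤b
  depth-bounds {g = g} (g<H , inj₂ refl) = ≤-trans (s≤s z≤n) (H<b∸g g<H) , m∸n≤m (b k) g

  depth-unique : ∀ {j g g′} → Depth j g → Depth j g′ → g ≡ g′
  depth-unique (_ , inj₁ refl) (_ , inj₁ e) = suc-injective e
  depth-unique (g<H , inj₂ refl) (g′<H , inj₂ e) =
    ∸-cancelˡ-≡ (<⇒≤ (<H⇒<b g<H)) (<⇒≤ (<H⇒<b g′<H)) e
  depth-unique (g<H , inj₁ refl) (g′<H , inj₂ e) = ⊥-elim (<⇒≱ (H<b∸g g′<H) (subst (_≤ H) e g<H))
  depth-unique (g<H , inj₂ refl) (g′<H , inj₁ e) = ⊥-elim (<⇒≱ (H<b∸g g<H) (subst (_≤ H) (sym e) g′<H))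

  column-depth : ∀ {j} → 1 ≤ j → j ≤ b k → Σ ℕ (Depth j)
  column-depth {suc g} _ j≤b with suc g ≤? H
  ... | yes g<H = g , g<H , inj₁ refl
  ... | no g≮H  = b k ∸ suc g , b∸j<H , inj₂ (sym (m∸[m∸n]≡n j≤b))
    where
    b∸j<H : b k ∸ suc g < H
    b∸j<H = +-cancelʳ-< (suc g) (b k ∸ suc g) H
              (subst (_< H + suc g) (sym (trans (m∸n+n≡m j≤b) b≡H+H)) (+-monoʳ-< H (≰⇒> g≮H)))

  -- S_{k,1} has the comparators of kind wrap, S_{k,2(g+1)} those of kind cross, and
  -- S_{k,2(g+1)+1} those of kinds left and right; a comparator of kind κ in row i
  -- joins (column lower κ, row i) to (column upper κ, row i + offset κ).
  data Kind : Stage → Set where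
    wrap  : Kind first
    cross : ∀ {g} → g < H → Kind (even g)
    left  : ∀ {g} → g < H → Kind (odd g)
    right : ∀ {g} → g < H → Kind (odd g)

  lower upper offset : ∀ {s} → Kind s → ℕ
  lower wrap              = b k
  lower (cross {g} _)     = suc g
  lower (left {g} _)      = suc g
  lower (right {g} _)     = b k ∸ suc g
  upper wrap              = 1
  upper (cross {g} _)     = b k ∸ g
  upper (left {g} _)      = suc (suc g)
  upper (right {g} _)     = b k ∸ g
  offset wrap             = 1
  offset (cross {g} _)    = 2 ^ (k ∸ suc g ∸ 1) ∸ 1
  offset (left _)         = 0
  offset (right _)        = 0

  comparator : ∀ {s} → Kind s → ℕ → Comparator
  comparator κ i = register (lower κ) i , register (upper κ) (i + offset κ)

  comparator-cong : ∀ {s} (κ κ′ : Kind s) → lower κ ≡ lower κ′ → upper κ ≡ upper κ′ →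
                    offset κ ≡ offset κ′ → ∀ i → comparator κ i ≡ comparator κ′ i
  comparator-cong _ _ l u o i =
    cong₂ _,_ (cong (λ j → register j i) l) (cong₂ (λ j d → register j (i + d)) u o)

  same-lower : ∀ {s} (κ κ′ : Kind s) → lower κ ≡ lower κ′ →
               upper κ ≡ upper κ′ × offset κ ≡ offset κ′
  same-lower wrap      wrap      _ = refl , refl
  same-lower (cross _) (cross _) _ = refl , refl
  same-lower (left _)  (left _)  _ = refl , refl
  same-lower (right _) (right _) _ = refl , refl
  same-lower (left g<H) (right _) e = trans (cong suc e) (sym (b∸g≡1+b∸1+g (<H⇒<b g<H))) , refl
  same-lower (right g<H) (left _) e = trans (b∸g≡1+b∸1+g (<H⇒<b g<H)) (cong suc e) , refl

  same-upper : ∀ {s} (κ κ′ : Kind s) → upper κ ≡ upper κ′ →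
               lower κ ≡ lower κ′ × offset κ ≡ offset κ′
  same-upper wrap      wrap      _ = refl , refl
  same-upper (cross _) (cross _) _ = refl , refl
  same-upper (left _)  (left _)  _ = refl , refl
  same-upper (right _) (right _) _ = refl , refl
  same-upper (left g<H) (right _) e = suc-injective (trans e (b∸g≡1+b∸1+g (<H⇒<b g<H))) , refl
  same-upper (right g<H) (left _) e = suc-injective (trans (sym (b∸g≡1+b∸1+g (<H⇒<b g<H))) e) , refl

  lower≢upper : ∀ {s} (κ κ′ : Kind s) → lower κ ≢ upper κ′
  lower≢upper wrap       wrap      e = even≢odd H 0 e
  lower≢upper (cross g<H) (cross _) e = b∸p≢1+p (<⇒≤ (<H⇒<b g<H)) (sym e)
  lower≢upper (left _)   (left _)  e = 1+n≢n (sym e)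
  lower≢upper (left g<H) (right _) e = b∸p≢1+p (<⇒≤ (<H⇒<b g<H)) (sym e)
  lower≢upper (right g<H) (left _) e = b∸p≢1+p (<H⇒<b g<H) e
  lower≢upper (right g<H) (right _) e = 1+n≢n (trans (sym (b∸g≡1+b∸1+g (<H⇒<b g<H))) (sym e))

  Acts : ℕ → Stage → Set
  Acts j s = Σ ℕ λ g → Σ ℕ λ e → Depth j g × Active g e s

  acts-bounds : ∀ {j s} → Acts j s → 1 ≤ j × j ≤ b k
  acts-bounds (_ , _ , δ , _) = depth-bounds δ

  -- Once g + 1 = H, the column b k ∸ suc g = H = suc g is reached from both edges.
  lower-acts : ∀ {s} (κ : Kind s) → Acts (lower κ) s
  lower-acts wrap        = 0 , 0 , (0<H , inj₂ refl) , before
  lower-acts (cross g<H) = _ , 1 , (g<H , inj₁ refl) , at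
  lower-acts (left g<H)  = _ , 2 , (g<H , inj₁ refl) , after
  lower-acts (right {g} g<H) with suc g <? H
  ... | yes g+1<H = suc g , 0 , (g+1<H , inj₂ refl) , before
  ... | no g+1≮H  = g , 2 , (g<H , inj₁ middle) , after
    where
    H≡1+g : H ≡ suc g
    H≡1+g = ≤-antisym (≮⇒≥ g+1≮H) g<H
    middle : b k ∸ suc g ≡ suc g
    middle = trans (cong (b k ∸_) (sym H≡1+g)) (trans b∸H≡H H≡1+g)

  upper-acts : ∀ {s} (κ : Kind s) → Acts (upper κ) s
  upper-acts wrap        = 0 , 0 , (0<H , inj₁ refl) , before
  upper-acts (cross g<H) = _ , 1 , (g<H , inj₂ refl) , at
  upper-acts (right g<H) = _ , 2 , (g<H , inj₂ refl) , after
  upper-acts (left {g} g<H) with suc g <? H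
  ... | yes g+1<H = suc g , 0 , (g+1<H , inj₁ refl) , before
  ... | no g+1≮H  = g , 2 , (g<H , inj₂ middle) , after
    where
    H≡1+g : H ≡ suc g
    H≡1+g = ≤-antisym (≮⇒≥ g+1≮H) g<H
    middle : suc (suc g) ≡ b k ∸ g
    middle = sym (trans (b∸g≡1+b∸1+g (<H⇒<b g<H))
                        (cong suc (trans (cong (b k ∸_) (sym H≡1+g)) (trans b∸H≡H H≡1+g))))

  InLayer : ℕ → Stage → Set
  InLayer r s = stage-index s % 3 ≡ r % 3

  acts-unique : ∀ r {j s s′} → InLayer r s → InLayer r s′ → Acts j s → Acts j s′ → s ≡ s′
  acts-unique r {s = s} {s′} inL inL′ (g , e , δ , α) (g′ , e′ , δ′ , α′) with depth-unique δ δ′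
  ... | refl with %3-cancelʳ-window (suc (2 * g)) (active-≤2 α) (active-≤2 α′) (begin
        (e + suc (2 * g)) % 3    ≡⟨ cong (_% 3) (sym (active-index α)) ⟩
        stage-index s % 3        ≡⟨ trans inL (sym inL′) ⟩
        stage-index s′ % 3       ≡⟨ cong (_% 3) (active-index α′) ⟩
        (e′ + suc (2 * g)) % 3   ∎)
    where open ≡-Reasoning
  ... | refl = active-injective α α′

  acts-in-layer : ∀ r g → Σ Stage λ s → Σ ℕ λ e → Active g e s × InLayer r s
  acts-in-layer r g with residue-in-window 2 (suc (2 * g)) r
  ... | e , e≤2 , eq with active-of g e≤2
  ...   | s , α = s , e , α , trans (cong (_% 3) (active-index α)) eq

  Role : ℕ → Stage → Set
  Role j s = (Σ (Kind s) λ κ → lower κ ≡ j) ⊎ (Σ (Kind s) λ κ → upper κ ≡ j)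

  role : ∀ {j g e s} → Depth j g → Active g e s → Role j s
  role {g = zero}  (_ , inj₁ refl) before = inj₂ (wrap , refl)
  role {g = zero}  (_ , inj₂ refl) before = inj₁ (wrap , refl)
  role {g = suc g} (g<H , inj₁ refl) before = inj₂ (left (<⇒≤ g<H) , refl)
  role {g = suc g} (g<H , inj₂ refl) before = inj₁ (right (<⇒≤ g<H) , refl)
  role (g<H , inj₁ refl) at    = inj₁ (cross g<H , refl)
  role (g<H , inj₂ refl) at    = inj₂ (cross g<H , refl)
  role (g<H , inj₁ refl) after = inj₁ (left g<H , refl)
  role (g<H , inj₂ refl) after = inj₂ (right g<H , refl)

  register-injective : ∀ {j j′ s s′} i i′ → Acts j s → Acts j′ s′ →
                       register j i ≡ register j′ i′ → j ≡ j′ × i ≡ i′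
  register-injective i i′ acts acts′ =
    column-row-injective (b k) i i′ (proj₁ (acts-bounds acts)) (proj₂ (acts-bounds acts))
                                    (proj₁ (acts-bounds acts′)) (proj₂ (acts-bounds acts′))

  data InStage (s : Stage) (c : Comparator) : Set where
    row : (κ : Kind s) (i : ℕ) → i + offset κ < n k → c ≡ comparator κ i → InStage s c

  span≥1 : ∀ g → 1 ≤ 2 ^ (k ∸ suc g ∸ 1)
  span≥1 g = m^n>0 2 (k ∸ suc g ∸ 1)

  1≤n : 1 ≤ n k
  1≤n = ≤-trans (span≥1 0) (span≤n k 0 3≤k)

  cross-upper-coord : ∀ {g} → g < H → ∀ i →
    b k * (i + 2 ^ (k ∸ suc g ∸ 1) ∸ 1) + b k ∸ suc g + 1 ≡
    register (b k ∸ g) (i + (2 ^ (k ∸ suc g ∸ 1) ∸ 1))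
  cross-upper-coord {g} g<H i =
    trans (cong (λ m → b k * m + b k ∸ suc g + 1) (+-∸-assoc i (span≥1 g)))
          (row-end-next-coord (b k) _ (<H⇒<b g<H))

  kind-stage-bound : ∀ {s} → Kind s → stage-index s ≤ suc (2 * H)
  kind-stage-bound wrap        = s≤s z≤n
  kind-stage-bound (cross g<H) = m≤n⇒m≤1+n (*-monoʳ-≤ 2 g<H)
  kind-stage-bound (left g<H)  = s≤s (*-monoʳ-≤ 2 g<H)
  kind-stage-bound (right g<H) = s≤s (*-monoʳ-≤ 2 g<H)

  ∈S⁻ : ∀ s {c} → stage-index s ≤ suc (2 * H) → c ∈ S k (stage-index s) → InStage s c
  ∈S⁻ first _ c∈ with ∈-map⁻ _ c∈
  ... | i , i∈ , refl =
    row wrap i (m≤o∸n⇒m+n≤o (suc i) 1≤n (∈-upTo⁻ i∈))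
        (cong₂ _,_ (*-suc-comm (b k) i) (wrap-upper-coord (b k) i))
  ∈S⁻ (even g) bound c∈ with ∈-map⁻ _ (subst (_ ∈_) (S-stage k (even g)) c∈)
  ... | i , i∈ , refl =
    row (cross g<H) i (<∸+1⇒+∸1< (span≥1 g) (span≤n k g 3≤k) (∈-upTo⁻ i∈))
        (cong₂ _,_ (row-coord (b k) i (suc g)) (cross-upper-coord g<H i))
    where g<H = 2*m≤1+2*n⇒m≤n bound
  ∈S⁻ (odd g) bound c∈ with find (∈-concatMap⁻ _ {xs = upTo (n k)} (subst (_ ∈_) (S-stage k (odd g)) c∈))
  ... | i , i∈ , here refl =
    row (left g<H) i (subst (_< n k) (sym (+-identityʳ i)) (∈-upTo⁻ i∈))
        (cong₂ _,_ (row-coord (b k) i (suc g)) (next-row-coord (b k) i (suc g)))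
    where g<H = 2*m≤1+2*n⇒m≤n (≤-pred (m≤n⇒m≤1+n bound))
  ... | i , i∈ , there (here refl) =
    row (right g<H) i (subst (_< n k) (sym (+-identityʳ i)) (∈-upTo⁻ i∈))
        (cong₂ _,_ (row-end-coord (b k) i (<H⇒<b g<H))
                   (trans (row-end-next-coord (b k) i (<H⇒<b g<H))
                          (cong (register (b k ∸ g)) (sym (+-identityʳ i)))))
    where g<H = 2*m≤1+2*n⇒m≤n (≤-pred (m≤n⇒m≤1+n bound))

  ∈S⁺ : ∀ {s} (κ : Kind s) i → i + offset κ < n k → comparator κ i ∈ S k (stage-index s)
  ∈S⁺ wrap i lt =
    subst (_∈ S₁ k) (cong₂ _,_ (*-suc-comm (b k) i) (wrap-upper-coord (b k) i))
          (∈-map⁺ _ (∈-upTo⁺ (m+n≤o⇒m≤o∸n (suc i) lt)))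
  ∈S⁺ (cross {g} g<H) i lt =
    subst (comparator (cross g<H) i ∈_) (sym (S-stage k (even g)))
      (subst (_∈ S-even k (suc g)) (cong₂ _,_ (row-coord (b k) i (suc g)) (cross-upper-coord g<H i))
             (∈-map⁺ _ (∈-upTo⁺ (+∸1<⇒<∸+1 (span≥1 g) lt))))
  ∈S⁺ (left {g} g<H) i lt =
    subst (comparator (left g<H) i ∈_) (sym (S-stage k (odd g)))
      (∈-concatMap⁺ _ (lose (∈-upTo⁺ (subst (_< n k) (+-identityʳ i) lt))
        (here (sym (cong₂ _,_ (row-coord (b k) i (suc g)) (next-row-coord (b k) i (suc g)))))))
  ∈S⁺ (right {g} g<H) i lt =
    subst (comparator (right g<H) i ∈_) (sym (S-stage k (odd g)))
      (∈-concatMap⁺ _ (lose (∈-upTo⁺ (subst (_< n k) (+-identityʳ i) lt))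
        (there (here (sym (cong₂ _,_ (row-end-coord (b k) i (<H⇒<b g<H))
                                     (trans (row-end-next-coord (b k) i (<H⇒<b g<H))
                                            (cong (register (b k ∸ g)) (sym (+-identityʳ i))))))))))

  ∈T⁻ : ∀ r {c} → c ∈ T k r → Σ Stage λ s → InLayer r s × InStage s c
  ∈T⁻ r c∈
    with find (∈-concatMap⁻ (S k) {xs = filter (λ m → m % 3 ≟ r % 3) (map suc (upTo (2 * k ∸ 3)))} c∈)
  ... | m , m∈ , c∈S with ∈-filter⁻ (λ m → m % 3 ≟ r % 3) {xs = map suc (upTo (2 * k ∸ 3))} m∈
  ... | m∈′ , m≡r with ∈-map⁻ suc m∈′
  ... | m′ , m′∈ , refl with stage-of m′
  ... | s , s≡ =
    s , subst (λ m → m % 3 ≡ r % 3) (sym s≡) m≡r ,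
    ∈S⁻ s (subst (_≤ suc (2 * H)) (sym s≡) (subst (m′ <_) (2k∸3≡1+2[k∸2] k 3≤k) (∈-upTo⁻ m′∈)))
          (subst (λ m → _ ∈ S k m) (sym s≡) c∈S)

  ∈T⁺ : ∀ r {s c} → InLayer r s → Kind s → c ∈ S k (stage-index s) → c ∈ T k r
  ∈T⁺ r {s} inL κ = go (stage-index-positive s) (kind-stage-bound κ) inL
    where
    go : ∀ {m c} → 1 ≤ m → m ≤ suc (2 * H) → m % 3 ≡ r % 3 → c ∈ S k m → c ∈ T k r
    go {suc m′} _ (s≤s m′≤) m≡r c∈ =
      ∈-concatMap⁺ (S k) (lose (∈-filter⁺ (λ m → m % 3 ≟ r % 3)
        (∈-map⁺ suc (∈-upTo⁺ (subst (m′ <_) (sym (2k∸3≡1+2[k∸2] k 3≤k)) (s≤s m′≤)))) m≡r) c∈)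

  registers-meet : ∀ r {j j′ s s′} i i′ → InLayer r s → InLayer r s′ → Acts j s → Acts j′ s′ →
                   register j i ≡ register j′ i′ → j ≡ j′ × i ≡ i′ × s ≡ s′
  registers-meet r i i′ inL inL′ acts acts′ eq with register-injective i i′ acts acts′ eq
  ... | refl , i≡i′ = refl , i≡i′ , acts-unique r inL inL′ acts acts′

  lower-only : ∀ r {s} → InLayer r s → (κ : Kind s) → ∀ {i c} → c ∈ T k r →
               Touches (register (lower κ) i) c → i + offset κ < n k × c ≡ comparator κ i
  lower-only r inL κ {i} c∈ touch with ∈T⁻ r c∈
  ... | s′ , inL′ , row κ′ i′ lt′ refl with touch
  ... | inj₁ eq with registers-meet r i i′ inL inL′ (lower-acts κ) (lower-acts κ′) eq
  ...   | same , refl , refl with same-lower κ κ′ same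
  ...     | same-up , same-off =
    subst (λ d → i′ + d < n k) (sym same-off) lt′ , sym (comparator-cong κ κ′ same same-up same-off i′)
  lower-only r inL κ {i} c∈ touch | s′ , inL′ , row κ′ i′ lt′ refl | inj₂ eq
    with registers-meet r i (i′ + offset κ′) inL inL′ (lower-acts κ) (upper-acts κ′) eq
  ... | same , _ , refl = ⊥-elim (lower≢upper κ κ′ same)

  upper-only : ∀ r {s} → InLayer r s → (κ : Kind s) → ∀ {i c} → c ∈ T k r →
               Touches (register (upper κ) i) c → offset κ ≤ i × c ≡ comparator κ (i ∸ offset κ)
  upper-only r inL κ {i} c∈ touch with ∈T⁻ r c∈
  ... | s′ , inL′ , row κ′ i′ lt′ refl with touch
  ... | inj₂ eq with registers-meet r i (i′ + offset κ′) inL inL′ (upper-acts κ) (upper-acts κ′) eq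
  ...   | same , refl , refl with same-upper κ κ′ same
  ...     | same-low , same-off =
    subst (_≤ i′ + offset κ′) (sym same-off) (m≤n+m _ i′) ,
    trans (sym (comparator-cong κ κ′ same-low same same-off i′))
          (cong (comparator κ) (sym (trans (cong (i′ + offset κ′ ∸_) same-off) (m+n∸n≡m i′ (offset κ′)))))
  upper-only r inL κ {i} c∈ touch | s′ , inL′ , row κ′ i′ lt′ refl | inj₁ eq
    with registers-meet r i i′ inL inL′ (upper-acts κ) (lower-acts κ′) eq
  ... | same , _ , refl = ⊥-elim (lower≢upper κ′ κ (sym same))

  module _ (x : Content) (r : ℕ) {s} (inL : InLayer r s) (κ : Kind s) where

    private
      y : Content
      y = applyLayer (T k r) x

    lower-inside : ∀ i → i + offset κ < n k →
                   y (register (lower κ) i) ≡ x (register (lower κ) i) ∧ x (register (upper κ) (i + offset κ))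
    lower-inside i lt =
      applyLayer-min (T k r) x (∈T⁺ r inL κ (∈S⁺ κ i lt)) (λ c∈ → proj₂ ∘ lower-only r inL κ {i} c∈)

    lower-outside : ∀ i → ¬ i + offset κ < n k → y (register (lower κ) i) ≡ x (register (lower κ) i)
    lower-outside i out = applyLayer-untouched (T k r) x _ (λ c∈ → out ∘ proj₁ ∘ lower-only r inL κ {i} c∈)

    upper-inside : ∀ i → offset κ ≤ i → i < n k →
                   y (register (upper κ) i) ≡ x (register (lower κ) (i ∸ offset κ)) ∨ x (register (upper κ) i)
    upper-inside i d≤i i<n =
      applyLayer-max (T k r) x distinct (subst (_∈ T k r) ends (∈T⁺ r inL κ (∈S⁺ κ _ lt)))
                     (λ c∈ touch → trans (proj₂ (upper-only r inL κ {i} c∈ touch)) ends)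
      where
      ends : comparator κ (i ∸ offset κ) ≡ (register (lower κ) (i ∸ offset κ) , register (upper κ) i)
      ends = cong (λ m → register (lower κ) (i ∸ offset κ) , register (upper κ) m) (m∸n+n≡m d≤i)
      lt : i ∸ offset κ + offset κ < n k
      lt = subst (_< n k) (sym (m∸n+n≡m d≤i)) i<n
      distinct : register (upper κ) i ≢ register (lower κ) (i ∸ offset κ)
      distinct eq =
        lower≢upper κ κ (sym (proj₁ (register-injective i (i ∸ offset κ) (upper-acts κ) (lower-acts κ) eq)))

    upper-outside : ∀ i → i < offset κ → y (register (upper κ) i) ≡ x (register (upper κ) i)
    upper-outside i i<d =
      applyLayer-untouched (T k r) x _ (λ c∈ → <⇒≱ i<d ∘ proj₁ ∘ upper-only r inL κ {i} c∈)

  ColumnsSorted : Content → Set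
  ColumnsSorted x = ∀ {j} → 1 ≤ j → j ≤ b k → Sorted (n k) (column x j)

  acts-sorted : ∀ {x j s} → ColumnsSorted x → Acts j s → Sorted (n k) (column x j)
  acts-sorted sorted acts = sorted (proj₁ (acts-bounds acts)) (proj₂ (acts-bounds acts))

  layer-preserves-sorted : ∀ r {x} → ColumnsSorted x → ColumnsSorted (applyLayer (T k r) x)
  layer-preserves-sorted r {x} sorted 1≤j j≤b with column-depth 1≤j j≤b
  ... | g , δ with acts-in-layer r g
  ... | s , e , α , inL with role δ α
  ... | inj₁ (κ , refl) =
    min-shift-sorted (acts-sorted {x} sorted (lower-acts κ)) (acts-sorted {x} sorted (upper-acts κ))
                     (lower-inside x r inL κ) (lower-outside x r inL κ)
  ... | inj₂ (κ , refl) =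
    max-shift-sorted (acts-sorted {x} sorted (upper-acts κ)) (acts-sorted {x} sorted (lower-acts κ))
                     (upper-inside x r inL κ) (upper-outside x r inL κ)

  run-preserves-sorted : ∀ {x} → ColumnsSorted x → ∀ t → ColumnsSorted (run k x t)
  run-preserves-sorted sorted zero    = sorted
  run-preserves-sorted sorted (suc t) = layer-preserves-sorted (t % 3 + 1) (run-preserves-sorted sorted t)

  -- Consecutive registers of a column are b k = 2 H apart, hence of equal parity.
  TwoSorted⇒ColumnsSorted : ∀ {x} → TwoSorted k x → ColumnsSorted x
  TwoSorted⇒ColumnsSorted two-sorted {j} 1≤j j≤b i i+1<n =
    two-sorted (register j i) (register j (suc i))
      (≤-trans 1≤j (m≤m+n j _))
      (+-monoʳ-≤ j (m≤n+m _ (b k)))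
      (≤-trans (+-monoˡ-≤ _ j≤b) (*-monoˡ-≤ (b k) i+1<n))
      (sym (trans (cong (_% 2) (next-register j i H)) ([m+kn]%n≡m%n (register j i) H 2)))
    where
    next-register : ∀ j i H → j + (2 * H + i * (2 * H)) ≡ j + i * (2 * H) + H * 2
    next-register = solve-∀

lemma1 : (k : ℕ) → 3 ≤ k → (x : Content) → TwoSorted k x →
           ∀ s j → 1 ≤ j → j ≤ b k → ColumnSorted k (run k x s) j
lemma1 k 3≤k x two-sorted s j 1≤j j≤b i i′ i≤i′ i′<n =
  Sorted⇒monotone (run-preserves-sorted (TwoSorted⇒ColumnsSorted two-sorted) s 1≤j j≤b) i≤i′ i′<n
  where open Network k 3≤k
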